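{- For every Boolean function $f:\{0,1\}^n\to\{ -1,1\}$ that depends on all of its $n$ input variables, $\mathsf{s}(f)\sqrt{\mathsf{sparsity}(f)}\ge n$.
   Context: $\mathsf{s}(f)=\max_{x}|\{i\in[n]: f(x\oplus e_i)\ne f(x)\}|$ is the sensitivity. $\mathsf{sparsity}(f)$ is the number of $S\subseteq[n]$ with nonzero Fourier coefficient $\hat f(S)=2^{ -n}\sum_x f(x)(-1)^{\sum_{i\in S}x_i}$ (for $\{0,1\}$-valued $f$ one uses $1-2f$). -}

module Defs where

open import Data.Bool using (Bool; true; false; not; _∧_)
open import Data.Nat using (ℕ; zero; suc; _⊔_; _*_; _≤_)
open import Data.Integer as ℤ using (ℤ)
open import Data.Fin using (Fin)
open import Data.Vec using (Vec; []; _∷_; _[_]%=_; zipWith; toList)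
open import Data.List using (List; []; _∷_; map; _++_; length; filter; foldr; allFin)
open import Relation.Nullary using (¬_)
open import Relation.Nullary.Decidable using (¬?)
open import Relation.Binary.PropositionalEquality using (_≡_)
open import Data.Product using (∃)
open import Data.Sum using (_⊎_)

-- Points of the hypercube {0,1}^n  (false = 0, true = 1).
Cube : ℕ → Set
Cube n = Vec Bool n

allCube : (n : ℕ) → List (Cube n)
allCube zero = [] ∷ []
allCube (suc n) = map (false ∷_) (allCube n) ++ map (true ∷_) (allCube n)

flipAt : ∀ {n} → Fin n → Cube n → Cube n
flipAt i x = x [ i ]%= not

IsPM1 : ∀ {n} → (Cube n → ℤ) → Set
IsPM1 {n} f = ∀ (x : Cube n) → (f x ≡ ℤ.+ 1) ⊎ (f x ≡ ℤ.- (ℤ.+ 1))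

DependsOn : ∀ {n} → (Cube n → ℤ) → Fin n → Set
DependsOn f i = ∃ λ x → ¬ (f (flipAt i x) ≡ f x)

DependsOnAll : ∀ {n} → (Cube n → ℤ) → Set
DependsOnAll {n} f = ∀ (i : Fin n) → DependsOn f i

sensAt : ∀ {n} → (Cube n → ℤ) → Cube n → ℕ
sensAt {n} f x = length (filter (λ i → ¬? (f (flipAt i x) ℤ.≟ f x)) (allFin n))

sensitivity : ∀ {n} → (Cube n → ℤ) → ℕ
sensitivity {n} f = foldr (λ x m → sensAt f x ⊔ m) 0 (allCube n)

-- Character χ_S(x) = (-1)^{Σ_{i∈S} x_i}, subsets S ⊆ [n] given as indicator vectors.
parity : List Bool → Bool
parity [] = false
parity (b ∷ bs) = if′ b bs
  where
  if′ : Bool → List Bool → Bool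
  if′ true  bs = not (parity bs)
  if′ false bs = parity bs

χ : ∀ {n} → Cube n → Cube n → ℤ
χ S x with parity (toList (zipWith _∧_ S x))
... | false = ℤ.+ 1
... | true  = ℤ.- (ℤ.+ 1)

sumℤ : List ℤ → ℤ
sumℤ = foldr ℤ._+_ (ℤ.+ 0)

-- 2^n · f̂(S) = Σ_x f(x) χ_S(x); it is nonzero iff f̂(S) is nonzero.
scaledFourier : ∀ {n} → (Cube n → ℤ) → Cube n → ℤ
scaledFourier {n} f S = sumℤ (map (λ x → f x ℤ.* χ S x) (allCube n))

sparsity : ∀ {n} → (Cube n → ℤ) → ℕ
sparsity {n} f = length (filter (λ S → ¬? (scaledFourier f S ℤ.≟ ℤ.+ 0)) (allCube n))

-- Write F̂ f S = Σ_x f(x) χ_S(x) = 2^n f̂(S) and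
-- u(S) = |S| |F̂ f S|.  The proof combines three estimates:
--   (1) total influence: if f depends on variable i, Fourier inversion at a
--       point where f changes along eᵢ gives Σ_{S ∋ i} |F̂ f S| ≥ 2^n;
--       summing over i yields Σ_S u(S) ≥ n 2^n;
--   (2) Cauchy–Schwarz over the support of F̂ f:
--       (Σ_S u(S))² ≤ sparsity(f) · Σ_S u(S)²;
--   (3) spectral identity: the hypercube Laplacian L f(x) = Σᵢ (f x − f(x ⊕ eᵢ))
--       has coefficients 2|S| F̂ f S and, for ±1-valued f, values 2 f(x) s_f(x);
--       Parseval for L f gives Σ_S u(S)² = 2^n Σ_x s_f(x)² ≤ 4^n s(f)².
-- Chaining (1)–(3) and cancelling 4^n gives the theorem.
module Submission where

open import Defs
open import Algebra.Bundles using (CommutativeSemiring)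
open import Data.Bool using (Bool; true; false; not; _∧_)
open import Data.Fin using (Fin; zero; suc)
open import Data.List using (List; []; _∷_; map; _++_; foldr; length; filter; allFin)
open import Data.Nat as ℕ using (ℕ; zero; suc)
open import Data.Vec using ([]; _∷_)

_² : ℕ → ℕ
n ² = n ℕ.* n

module Sums {c ℓ} (R : CommutativeSemiring c ℓ) where
  open CommutativeSemiring R hiding (zero)
  open import Relation.Binary.Reasoning.Setoid setoid

  Σ : {A : Set} → List A → (A → Carrier) → Carrier
  Σ L φ = foldr _+_ 0# (map φ L)

  Σ-cong : {A : Set} (L : List A) {φ ψ : A → Carrier} →
           (∀ x → φ x ≈ ψ x) → Σ L φ ≈ Σ L ψ
  Σ-cong []      eq = refl
  Σ-cong (x ∷ L) eq = +-cong (eq x) (Σ-cong L eq)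

  Σ-++ : {A : Set} (L M : List A) (φ : A → Carrier) →
         Σ (L ++ M) φ ≈ Σ L φ + Σ M φ
  Σ-++ []      M φ = sym (+-identityˡ _)
  Σ-++ (x ∷ L) M φ = trans (+-cong refl (Σ-++ L M φ)) (sym (+-assoc (φ x) _ _))

  Σ-map : {A B : Set} (L : List A) (h : A → B) (φ : B → Carrier) →
          Σ (map h L) φ ≈ Σ L (λ x → φ (h x))
  Σ-map []      h φ = refl
  Σ-map (x ∷ L) h φ = +-cong refl (Σ-map L h φ)

  Σ-zero : {A : Set} (L : List A) → Σ L (λ _ → 0#) ≈ 0#
  Σ-zero []      = refl
  Σ-zero (x ∷ L) = trans (+-identityˡ _) (Σ-zero L)

  Σ-+ : {A : Set} (L : List A) (φ ψ : A → Carrier) →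
        Σ L (λ x → φ x + ψ x) ≈ Σ L φ + Σ L ψ
  Σ-+ []      φ ψ = sym (+-identityˡ 0#)
  Σ-+ (x ∷ L) φ ψ = begin
    (φ x + ψ x) + Σ L (λ y → φ y + ψ y) ≈⟨ +-cong refl (Σ-+ L φ ψ) ⟩
    (φ x + ψ x) + (Σ L φ + Σ L ψ)       ≈⟨ +-assoc (φ x) (ψ x) _ ⟩
    φ x + (ψ x + (Σ L φ + Σ L ψ))       ≈⟨ +-cong refl (sym (+-assoc (ψ x) _ _)) ⟩
    φ x + ((ψ x + Σ L φ) + Σ L ψ)       ≈⟨ +-cong refl (+-cong (+-comm (ψ x) _) refl) ⟩
    φ x + ((Σ L φ + ψ x) + Σ L ψ)       ≈⟨ +-cong refl (+-assoc (Σ L φ) _ _) ⟩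
    φ x + (Σ L φ + (ψ x + Σ L ψ))       ≈⟨ sym (+-assoc (φ x) _ _) ⟩
    (φ x + Σ L φ) + (ψ x + Σ L ψ)       ∎

  Σ-*ˡ : {A : Set} (L : List A) (a : Carrier) (φ : A → Carrier) →
         Σ L (λ x → a * φ x) ≈ a * Σ L φ
  Σ-*ˡ []      a φ = sym (zeroʳ a)
  Σ-*ˡ (x ∷ L) a φ = trans (+-cong refl (Σ-*ˡ L a φ)) (sym (distribˡ a (φ x) _))

  Σ-*ʳ : {A : Set} (L : List A) (a : Carrier) (φ : A → Carrier) →
         Σ L (λ x → φ x * a) ≈ Σ L φ * a
  Σ-*ʳ L a φ = trans (Σ-cong L (λ x → *-comm (φ x) a)) (trans (Σ-*ˡ L a φ) (*-comm a _))

  Σ-swap : {A B : Set} (L : List A) (M : List B) (φ : A → B → Carrier) →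
           Σ L (λ x → Σ M (φ x)) ≈ Σ M (λ y → Σ L (λ x → φ x y))
  Σ-swap []      M φ = sym (Σ-zero M)
  Σ-swap (x ∷ L) M φ =
    trans (+-cong refl (Σ-swap L M φ)) (sym (Σ-+ M (φ x) (λ y → Σ L (λ x′ → φ x′ y))))

  Σ-product : {A : Set} (L : List A) (φ ψ : A → Carrier) →
              Σ L (λ x → Σ L (λ y → φ x * ψ y)) ≈ Σ L φ * Σ L ψ
  Σ-product L φ ψ = trans (Σ-cong L (λ x → Σ-*ˡ L (φ x) ψ)) (Σ-*ʳ L (Σ L ψ) φ)

  Σ-allCube-suc : ∀ {n} (φ : Cube (suc n) → Carrier) →
    Σ (allCube (suc n)) φ ≈ Σ (allCube n) (λ x → φ (false ∷ x)) + Σ (allCube n) (λ x → φ (true ∷ x))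
  Σ-allCube-suc {n} φ = trans (Σ-++ (map (false ∷_) (allCube n)) _ φ)
                              (+-cong (Σ-map (allCube n) _ φ) (Σ-map (allCube n) _ φ))

  -- Flipping a coordinate permutes the cube, so it leaves sums unchanged.
  Σ-flipAt : ∀ {n} (i : Fin n) (φ : Cube n → Carrier) →
             Σ (allCube n) (λ x → φ (flipAt i x)) ≈ Σ (allCube n) φ
  Σ-flipAt {suc n} zero φ = begin
    Σ (allCube (suc n)) (λ x → φ (flipAt zero x))                  ≈⟨ Σ-allCube-suc (λ x → φ (flipAt zero x)) ⟩
    Σ (allCube n) (λ x → φ (true ∷ x)) + Σ (allCube n) (λ x → φ (false ∷ x)) ≈⟨ +-comm _ _ ⟩
    Σ (allCube n) (λ x → φ (false ∷ x)) + Σ (allCube n) (λ x → φ (true ∷ x)) ≈⟨ sym (Σ-allCube-suc φ) ⟩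
    Σ (allCube (suc n)) φ                                          ∎
  Σ-flipAt {suc n} (suc i) φ =
    trans (Σ-allCube-suc (λ x → φ (flipAt (suc i) x)))
          (trans (+-cong (Σ-flipAt i (λ x → φ (false ∷ x))) (Σ-flipAt i (λ x → φ (true ∷ x))))
                 (sym (Σ-allCube-suc φ)))

-- Integer-valued Fourier analysis on {0,1}^n.  We work with the scaled
-- coefficients F̂ g S = 2^n ĝ(S) = Σ_x g x χ_S(x), which are integers.
module Fourier where
  open import Data.Integer using (ℤ; +_; -_; _+_; _*_; _-_; ∣_∣; -[1+_])
  import Data.Integer.Properties as ℤP
  open import Data.Integer.Tactic.RingSolver using (solve-∀)
  import Data.Nat.Properties as ℕP
  import Data.Nat.Tactic.RingSolver as ℕSolver
  open import Data.Product using (_,_)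
  open import Data.Sum using (_⊎_; inj₁; inj₂)
  open import Data.Vec using (lookup; zipWith; toList)
  open import Relation.Binary.PropositionalEquality
  open import Relation.Nullary using (¬_; yes; no; contradiction)
  open import Relation.Nullary.Decidable using (¬?)
  open Sums ℤP.+-*-commutativeSemiring
  module ℕΣ = Sums ℕP.+-*-commutativeSemiring

  Σ-neg : {A : Set} (L : List A) (φ : A → ℤ) → Σ L (λ x → - φ x) ≡ - Σ L φ
  Σ-neg L φ = trans (Σ-cong L (λ x → sym (ℤP.-1*i≡-i (φ x))))
                    (trans (Σ-*ˡ L (- + 1) φ) (ℤP.-1*i≡-i _))

  Σ-- : {A : Set} (L : List A) (φ ψ : A → ℤ) → Σ L (λ x → φ x - ψ x) ≡ Σ L φ - Σ L ψ
  Σ-- L φ ψ = trans (Σ-+ L φ (λ x → - ψ x)) (cong (λ t → Σ L φ + t) (Σ-neg L ψ))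

  +-Σ : {A : Set} (L : List A) (φ : A → ℕ) → + ℕΣ.Σ L φ ≡ Σ L (λ x → + φ x)
  +-Σ []      φ = refl
  +-Σ (x ∷ L) φ = trans (ℤP.pos-+ (φ x) _) (cong (λ t → + φ x + t) (+-Σ L φ))

  ∣Σ∣≤Σ∣∣ : {A : Set} (L : List A) (φ : A → ℤ) → ∣ Σ L φ ∣ ℕ.≤ ℕΣ.Σ L (λ x → ∣ φ x ∣)
  ∣Σ∣≤Σ∣∣ []      φ = ℕ.z≤n
  ∣Σ∣≤Σ∣∣ (x ∷ L) φ = ℕP.≤-trans (ℤP.∣i+j∣≤∣i∣+∣j∣ (φ x) _) (ℕP.+-monoʳ-≤ ∣ φ x ∣ (∣Σ∣≤Σ∣∣ L φ))

  square-∣∣ : ∀ a → a * a ≡ + (∣ a ∣ ℕ.* ∣ a ∣)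
  square-∣∣ (+ m)    = sym (ℤP.pos-* m m)
  square-∣∣ -[1+ m ] = refl

  sgn : Bool → ℤ
  sgn false = + 1
  sgn true  = - + 1

  bit : Bool → ℕ
  bit false = 0
  bit true  = 1

  sgn-not : ∀ b → sgn (not b) ≡ - sgn b
  sgn-not false = refl
  sgn-not true  = refl

  sgn-squared : ∀ b → sgn b * sgn b ≡ + 1
  sgn-squared false = refl
  sgn-squared true  = refl

  one-minus-sgn : ∀ b a → a - sgn b * a ≡ + (2 ℕ.* bit b) * a
  one-minus-sgn false = solve-∀
  one-minus-sgn true  = solve-∀

  sgn-∧-not : ∀ b c → sgn (b ∧ not c) ≡ sgn b * sgn (b ∧ c)
  sgn-∧-not false c = refl
  sgn-∧-not true  c = trans (sgn-not c) (sym (ℤP.-1*i≡-i (sgn c)))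

  sgn-parity-∷ : ∀ a bs → sgn (parity (a ∷ bs)) ≡ sgn a * sgn (parity bs)
  sgn-parity-∷ false bs = sym (ℤP.*-identityˡ _)
  sgn-parity-∷ true  bs = trans (sgn-not (parity bs)) (sym (ℤP.-1*i≡-i _))

  χ-sgn : ∀ {n} (S x : Cube n) → χ S x ≡ sgn (parity (toList (zipWith _∧_ S x)))
  χ-sgn S x with parity (toList (zipWith _∧_ S x))
  ... | false = refl
  ... | true  = refl

  ∣χ∣ : ∀ {n} (S x : Cube n) → ∣ χ S x ∣ ≡ 1
  ∣χ∣ S x rewrite χ-sgn S x with parity (toList (zipWith _∧_ S x))
  ... | false = refl
  ... | true  = refl

  χ-∷ : ∀ {n} b c (S x : Cube n) → χ (b ∷ S) (c ∷ x) ≡ sgn (b ∧ c) * χ S x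
  χ-∷ b c S x = trans (χ-sgn (b ∷ S) (c ∷ x))
    (trans (sgn-parity-∷ (b ∧ c) _) (cong (sgn (b ∧ c) *_) (sym (χ-sgn S x))))

  χ-flipAt : ∀ {n} (i : Fin n) (S x : Cube n) → χ S (flipAt i x) ≡ sgn (lookup S i) * χ S x
  χ-flipAt zero (b ∷ S) (c ∷ x) = begin
    χ (b ∷ S) (not c ∷ x)              ≡⟨ χ-∷ b (not c) S x ⟩
    sgn (b ∧ not c) * χ S x            ≡⟨ cong (_* χ S x) (sgn-∧-not b c) ⟩
    (sgn b * sgn (b ∧ c)) * χ S x      ≡⟨ ℤP.*-assoc (sgn b) _ _ ⟩
    sgn b * (sgn (b ∧ c) * χ S x)      ≡⟨ cong (sgn b *_) (sym (χ-∷ b c S x)) ⟩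
    sgn b * χ (b ∷ S) (c ∷ x)          ∎
    where open ≡-Reasoning
  χ-flipAt (suc i) (b ∷ S) (c ∷ x) = begin
    χ (b ∷ S) (c ∷ flipAt i x)                  ≡⟨ χ-∷ b c S (flipAt i x) ⟩
    sgn (b ∧ c) * χ S (flipAt i x)              ≡⟨ cong (sgn (b ∧ c) *_) (χ-flipAt i S x) ⟩
    sgn (b ∧ c) * (sgn (lookup S i) * χ S x)    ≡⟨ swap (sgn (b ∧ c)) (sgn (lookup S i)) (χ S x) ⟩
    sgn (lookup S i) * (sgn (b ∧ c) * χ S x)    ≡⟨ cong (sgn (lookup S i) *_) (sym (χ-∷ b c S x)) ⟩
    sgn (lookup S i) * χ (b ∷ S) (c ∷ x)        ∎
    where
    open ≡-Reasoning
    swap : ∀ p q r → p * (q * r) ≡ q * (p * r)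
    swap = solve-∀

  ∣χ-change∣ : ∀ {n} (i : Fin n) (S y : Cube n) →
               ∣ χ S y - χ S (flipAt i y) ∣ ≡ 2 ℕ.* bit (lookup S i)
  ∣χ-change∣ i S y = begin
    ∣ χ S y - χ S (flipAt i y) ∣                 ≡⟨ cong (λ t → ∣ χ S y - t ∣) (χ-flipAt i S y) ⟩
    ∣ χ S y - sgn b * χ S y ∣                    ≡⟨ cong ∣_∣ (one-minus-sgn b (χ S y)) ⟩
    ∣ + (2 ℕ.* bit b) * χ S y ∣                  ≡⟨ ℤP.abs-* (+ (2 ℕ.* bit b)) (χ S y) ⟩
    2 ℕ.* bit b ℕ.* ∣ χ S y ∣                    ≡⟨ cong (2 ℕ.* bit b ℕ.*_) (∣χ∣ S y) ⟩
    2 ℕ.* bit b ℕ.* 1                            ≡⟨ ℕP.*-identityʳ _ ⟩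
    2 ℕ.* bit b                                  ∎
    where
    open ≡-Reasoning
    b = lookup S i

  F̂ : ∀ {n} → (Cube n → ℤ) → Cube n → ℤ
  F̂ = scaledFourier

  restrict : ∀ {n} → Bool → (Cube (suc n) → ℤ) → Cube n → ℤ
  restrict b g x = g (b ∷ x)

  F̂-false : ∀ {n} (g : Cube (suc n) → ℤ) S →
            F̂ g (false ∷ S) ≡ F̂ (restrict false g) S + F̂ (restrict true g) S
  F̂-false g S = Σ-allCube-suc (λ y → g y * χ (false ∷ S) y)

  F̂-true : ∀ {n} (g : Cube (suc n) → ℤ) S →
           F̂ g (true ∷ S) ≡ F̂ (restrict false g) S - F̂ (restrict true g) S
  F̂-true {n} g S = trans (Σ-allCube-suc (λ y → g y * χ (true ∷ S) y))
    (cong (λ t → F̂ (restrict false g) S + t)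
      (trans (Σ-cong (allCube n) negate) (Σ-neg (allCube n) (λ x → g (true ∷ x) * χ S x))))
    where
    negate : ∀ x → g (true ∷ x) * χ (true ∷ S) (true ∷ x) ≡ - (g (true ∷ x) * χ S x)
    negate x = trans (cong (g (true ∷ x) *_) (trans (χ-∷ true true S x) (ℤP.-1*i≡-i _)))
                     (sym (ℤP.neg-distribʳ-* (g (true ∷ x)) (χ S x)))

  parseval : ∀ n (g : Cube n → ℤ) →
    Σ (allCube n) (λ S → F̂ g S * F̂ g S) ≡ + (2 ℕ.^ n) * Σ (allCube n) (λ x → g x * g x)
  parseval zero g = base (g [])
    where
    base : ∀ a → (a * + 1 + + 0) * (a * + 1 + + 0) + + 0 ≡ + 1 * (a * a + + 0)
    base = solve-∀
  parseval (suc n) g = begin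
    Σ (allCube (suc n)) (λ S → F̂ g S * F̂ g S)
      ≡⟨ Σ-allCube-suc (λ S → F̂ g S * F̂ g S) ⟩
    Σ A (λ S → F̂ g (false ∷ S) * F̂ g (false ∷ S)) + Σ A (λ S → F̂ g (true ∷ S) * F̂ g (true ∷ S))
      ≡⟨ sym (Σ-+ A _ _) ⟩
    Σ A (λ S → F̂ g (false ∷ S) * F̂ g (false ∷ S) + F̂ g (true ∷ S) * F̂ g (true ∷ S))
      ≡⟨ Σ-cong A (λ S → trans (cong₂ _+_ (cong₂ _*_ (F̂-false g S) (F̂-false g S))
                                         (cong₂ _*_ (F̂-true g S) (F̂-true g S)))
                               (parallelogram (F̂ g₀ S) (F̂ g₁ S))) ⟩
    Σ A (λ S → + 2 * (F̂ g₀ S * F̂ g₀ S + F̂ g₁ S * F̂ g₁ S))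
      ≡⟨ trans (Σ-*ˡ A (+ 2) _) (cong (+ 2 *_) (Σ-+ A _ _)) ⟩
    + 2 * (Σ A (λ S → F̂ g₀ S * F̂ g₀ S) + Σ A (λ S → F̂ g₁ S * F̂ g₁ S))
      ≡⟨ cong₂ (λ p q → + 2 * (p + q)) (parseval n g₀) (parseval n g₁) ⟩
    + 2 * (+ (2 ℕ.^ n) * Σ A (λ x → g₀ x * g₀ x) + + (2 ℕ.^ n) * Σ A (λ x → g₁ x * g₁ x))
      ≡⟨ regroup (+ (2 ℕ.^ n)) _ _ ⟩
    (+ 2 * + (2 ℕ.^ n)) * (Σ A (λ x → g₀ x * g₀ x) + Σ A (λ x → g₁ x * g₁ x))
      ≡⟨ cong₂ _*_ (sym (ℤP.pos-* 2 (2 ℕ.^ n))) (sym (Σ-allCube-suc (λ x → g x * g x))) ⟩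
    + (2 ℕ.^ suc n) * Σ (allCube (suc n)) (λ x → g x * g x)
      ∎
    where
    open ≡-Reasoning
    A = allCube n
    g₀ = restrict false g
    g₁ = restrict true g
    parallelogram : ∀ a b → (a + b) * (a + b) + (a - b) * (a - b) ≡ + 2 * (a * a + b * b)
    parallelogram = solve-∀
    regroup : ∀ N p q → + 2 * (N * p + N * q) ≡ (+ 2 * N) * (p + q)
    regroup = solve-∀

  inversion : ∀ n (g : Cube n → ℤ) y → Σ (allCube n) (λ S → F̂ g S * χ S y) ≡ + (2 ℕ.^ n) * g y
  inversion zero g [] = base (g [])
    where
    base : ∀ a → (a * + 1 + + 0) * + 1 + + 0 ≡ + 1 * a
    base = solve-∀
  inversion (suc n) g (c ∷ y) = begin
    Σ (allCube (suc n)) (λ S → F̂ g S * χ S (c ∷ y))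
      ≡⟨ Σ-allCube-suc (λ S → F̂ g S * χ S (c ∷ y)) ⟩
    Σ A (λ S → F̂ g (false ∷ S) * χ (false ∷ S) (c ∷ y)) + Σ A (λ S → F̂ g (true ∷ S) * χ (true ∷ S) (c ∷ y))
      ≡⟨ cong₂ _+_ (Σ-cong A even) (Σ-cong A odd) ⟩
    Σ A (λ S → a₀ S + a₁ S) + Σ A (λ S → sgn c * (a₀ S - a₁ S))
      ≡⟨ cong₂ _+_ (Σ-+ A a₀ a₁) (trans (Σ-*ˡ A (sgn c) _) (cong (sgn c *_) (Σ-- A a₀ a₁))) ⟩
    (Σ A a₀ + Σ A a₁) + sgn c * (Σ A a₀ - Σ A a₁)
      ≡⟨ cong₂ (λ p q → (p + q) + sgn c * (p - q)) (inversion n g₀ y) (inversion n g₁ y) ⟩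
    (N * g₀ y + N * g₁ y) + sgn c * (N * g₀ y - N * g₁ y)
      ≡⟨ factor N (g₀ y) (g₁ y) (sgn c) ⟩
    N * ((g₀ y + g₁ y) + sgn c * (g₀ y - g₁ y))
      ≡⟨ cong (N *_) (select c) ⟩
    N * (+ 2 * g (c ∷ y))
      ≡⟨ trans (sym (ℤP.*-assoc N (+ 2) _)) (cong (_* g (c ∷ y)) (sym (ℤP.pos-* (2 ℕ.^ n) 2))) ⟩
    + (2 ℕ.^ n ℕ.* 2) * g (c ∷ y)
      ≡⟨ cong (λ m → + m * g (c ∷ y)) (ℕP.*-comm (2 ℕ.^ n) 2) ⟩
    + (2 ℕ.^ suc n) * g (c ∷ y)
      ∎
    where
    open ≡-Reasoning
    A = allCube n
    N = + (2 ℕ.^ n)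
    g₀ = restrict false g
    g₁ = restrict true g
    a₀ a₁ : Cube n → ℤ
    a₀ S = F̂ g₀ S * χ S y
    a₁ S = F̂ g₁ S * χ S y
    even : ∀ S → F̂ g (false ∷ S) * χ S y ≡ a₀ S + a₁ S
    even S = trans (cong (_* χ S y) (F̂-false g S)) (ℤP.*-distribʳ-+ (χ S y) (F̂ g₀ S) (F̂ g₁ S))
    odd : ∀ S → F̂ g (true ∷ S) * χ (true ∷ S) (c ∷ y) ≡ sgn c * (a₀ S - a₁ S)
    odd S = trans (cong₂ _*_ (F̂-true g S) (χ-∷ true c S y)) (distribute (F̂ g₀ S) (F̂ g₁ S) (sgn c) (χ S y))
      where
      distribute : ∀ p q s x → (p - q) * (s * x) ≡ s * (p * x - q * x)
      distribute = solve-∀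
    factor : ∀ N p q s → (N * p + N * q) + s * (N * p - N * q) ≡ N * ((p + q) + s * (p - q))
    factor = solve-∀
    select : ∀ c → (g₀ y + g₁ y) + sgn c * (g₀ y - g₁ y) ≡ + 2 * g (c ∷ y)
    select false = keep-first (g₀ y) (g₁ y)
      where
      keep-first : ∀ p q → (p + q) + + 1 * (p - q) ≡ + 2 * p
      keep-first = solve-∀
    select true  = keep-second (g₀ y) (g₁ y)
      where
      keep-second : ∀ p q → (p + q) + - + 1 * (p - q) ≡ + 2 * q
      keep-second = solve-∀

  F̂-flipAt : ∀ {n} (g : Cube n → ℤ) (i : Fin n) (S : Cube n) →
             F̂ (λ x → g (flipAt i x)) S ≡ sgn (lookup S i) * F̂ g S
  F̂-flipAt {n} g i S = begin
    Σ (allCube n) (λ x → g (flipAt i x) * χ S x)                  ≡⟨ Σ-cong (allCube n) pointwise ⟩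
    Σ (allCube n) (λ x → s * (g (flipAt i x) * χ S (flipAt i x))) ≡⟨ Σ-*ˡ (allCube n) s _ ⟩
    s * Σ (allCube n) (λ x → g (flipAt i x) * χ S (flipAt i x))   ≡⟨ cong (s *_) (Σ-flipAt i (λ x → g x * χ S x)) ⟩
    s * F̂ g S                                                     ∎
    where
    open ≡-Reasoning
    s = sgn (lookup S i)
    rearrange : ∀ s a b → (s * s) * (a * b) ≡ s * (a * (s * b))
    rearrange = solve-∀
    pointwise : ∀ x → g (flipAt i x) * χ S x ≡ s * (g (flipAt i x) * χ S (flipAt i x))
    pointwise x = begin
      g (flipAt i x) * χ S x                  ≡⟨ sym (ℤP.*-identityˡ _) ⟩
      + 1 * (g (flipAt i x) * χ S x)          ≡⟨ cong (_* (g (flipAt i x) * χ S x)) (sym (sgn-squared (lookup S i))) ⟩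
      (s * s) * (g (flipAt i x) * χ S x)      ≡⟨ rearrange s (g (flipAt i x)) (χ S x) ⟩
      s * (g (flipAt i x) * (s * χ S x))      ≡⟨ cong (λ t → s * (g (flipAt i x) * t)) (sym (χ-flipAt i S x)) ⟩
      s * (g (flipAt i x) * χ S (flipAt i x)) ∎

  inversion-difference : ∀ {n} (g : Cube n → ℤ) (i : Fin n) (y : Cube n) →
    + (2 ℕ.^ n) * (g y - g (flipAt i y)) ≡ Σ (allCube n) (λ S → F̂ g S * (χ S y - χ S (flipAt i y)))
  inversion-difference {n} g i y = begin
    N * (g y - g y′)        ≡⟨ sym (factor N (g y) (g y′)) ⟩
    N * g y - N * g y′      ≡⟨ sym (cong₂ _-_ (inversion n g y) (inversion n g y′)) ⟩
    Σ (allCube n) (λ S → F̂ g S * χ S y) - Σ (allCube n) (λ S → F̂ g S * χ S y′)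
                            ≡⟨ sym (Σ-- (allCube n) _ _) ⟩
    Σ (allCube n) (λ S → F̂ g S * χ S y - F̂ g S * χ S y′)
                            ≡⟨ Σ-cong (allCube n) (λ S → factor (F̂ g S) (χ S y) (χ S y′)) ⟩
    Σ (allCube n) (λ S → F̂ g S * (χ S y - χ S y′)) ∎
    where
    open ≡-Reasoning
    N = + (2 ℕ.^ n)
    y′ = flipAt i y
    factor : ∀ N a b → N * a - N * b ≡ N * (a - b)
    factor = solve-∀

  IsSign : ℤ → Set
  IsSign a = (a ≡ + 1) ⊎ (a ≡ - + 1)

  sign-difference : ∀ {a b} → IsSign a → IsSign b → ¬ b ≡ a → a - b ≡ + 2 * a
  sign-difference (inj₁ refl) (inj₁ refl) b≢a = contradiction refl b≢a
  sign-difference (inj₁ refl) (inj₂ refl) b≢a = refl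
  sign-difference (inj₂ refl) (inj₁ refl) b≢a = refl
  sign-difference (inj₂ refl) (inj₂ refl) b≢a = contradiction refl b≢a

  ∣sign∣ : ∀ {a} → IsSign a → ∣ a ∣ ≡ 1
  ∣sign∣ (inj₁ refl) = refl
  ∣sign∣ (inj₂ refl) = refl

  -- By inversion 2^n (f y − f(y ⊕ eᵢ)) expands
  -- into the characters, whose change is 2·[i ∈ S]; apply the triangle
  -- inequality at a point y where f changes.
  influence-bound : ∀ {n} (f : Cube n → ℤ) → IsPM1 f → (i : Fin n) → DependsOn f i →
    2 ℕ.^ n ℕ.≤ ℕΣ.Σ (allCube n) (λ S → bit (lookup S i) ℕ.* ∣ F̂ f S ∣)
  influence-bound {n} f pm i (y , f-changes) = ℕP.*-cancelʳ-≤ _ _ 2 (begin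
    2 ℕ.^ n ℕ.* 2                                                ≡⟨ sym ∣scaled-change∣ ⟩
    ∣ N * (f y - f y′) ∣                                         ≡⟨ cong ∣_∣ (inversion-difference f i y) ⟩
    ∣ Σ (allCube n) (λ S → F̂ f S * (χ S y - χ S y′)) ∣           ≤⟨ ∣Σ∣≤Σ∣∣ (allCube n) _ ⟩
    ℕΣ.Σ (allCube n) (λ S → ∣ F̂ f S * (χ S y - χ S y′) ∣)       ≡⟨ ℕΣ.Σ-cong (allCube n) term ⟩
    ℕΣ.Σ (allCube n) (λ S → bit (lookup S i) ℕ.* ∣ F̂ f S ∣ ℕ.* 2) ≡⟨ ℕΣ.Σ-*ʳ (allCube n) 2 _ ⟩
    ℕΣ.Σ (allCube n) (λ S → bit (lookup S i) ℕ.* ∣ F̂ f S ∣) ℕ.* 2 ∎)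
    where
    open ℕP.≤-Reasoning
    N = + (2 ℕ.^ n)
    y′ = flipAt i y
    ∣scaled-change∣ : ∣ N * (f y - f y′) ∣ ≡ 2 ℕ.^ n ℕ.* 2
    ∣scaled-change∣ = trans (ℤP.abs-* N (f y - f y′)) (cong (2 ℕ.^ n ℕ.*_) (begin-equality
      ∣ f y - f y′ ∣  ≡⟨ cong ∣_∣ (sign-difference (pm y) (pm y′) f-changes) ⟩
      ∣ + 2 * f y ∣   ≡⟨ ℤP.abs-* (+ 2) (f y) ⟩
      2 ℕ.* ∣ f y ∣   ≡⟨ cong (2 ℕ.*_) (∣sign∣ (pm y)) ⟩
      2               ∎))
    term : ∀ S → ∣ F̂ f S * (χ S y - χ S y′) ∣ ≡ bit (lookup S i) ℕ.* ∣ F̂ f S ∣ ℕ.* 2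
    term S = trans (ℤP.abs-* (F̂ f S) _)
      (trans (cong (∣ F̂ f S ∣ ℕ.*_) (∣χ-change∣ i S y))
             (commute ∣ F̂ f S ∣ (bit (lookup S i))))
      where
      commute : ∀ a b → a ℕ.* (2 ℕ.* b) ≡ b ℕ.* a ℕ.* 2
      commute = ℕSolver.solve-∀

  weight : ∀ {n} → Cube n → ℕ
  weight {n} S = ℕΣ.Σ (allFin n) (λ i → bit (lookup S i))

  laplacian : ∀ {n} → (Cube n → ℤ) → Cube n → ℤ
  laplacian {n} g x = Σ (allFin n) (λ i → g x - g (flipAt i x))

  F̂-laplacian : ∀ {n} (g : Cube n → ℤ) S → F̂ (laplacian g) S ≡ + (2 ℕ.* weight S) * F̂ g S
  F̂-laplacian {n} g S = begin
    Σ (allCube n) (λ x → Σ (allFin n) (λ i → g x - g (flipAt i x)) * χ S x)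
      ≡⟨ Σ-cong (allCube n) (λ x → sym (Σ-*ʳ (allFin n) (χ S x) _)) ⟩
    Σ (allCube n) (λ x → Σ (allFin n) (λ i → (g x - g (flipAt i x)) * χ S x))
      ≡⟨ Σ-swap (allCube n) (allFin n) _ ⟩
    Σ (allFin n) (λ i → F̂ (λ x → g x - g (flipAt i x)) S)
      ≡⟨ Σ-cong (allFin n) eigen ⟩
    Σ (allFin n) (λ i → + (2 ℕ.* bit (lookup S i)) * F̂ g S)
      ≡⟨ Σ-*ʳ (allFin n) (F̂ g S) _ ⟩
    Σ (allFin n) (λ i → + (2 ℕ.* bit (lookup S i))) * F̂ g S
      ≡⟨ cong (_* F̂ g S) (trans (sym (+-Σ (allFin n) _)) (cong +_ (ℕΣ.Σ-*ˡ (allFin n) 2 _))) ⟩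
    + (2 ℕ.* weight S) * F̂ g S
      ∎
    where
    open ≡-Reasoning
    distrib : ∀ a b c → (a - b) * c ≡ a * c - b * c
    distrib = solve-∀
    eigen : ∀ i → F̂ (λ x → g x - g (flipAt i x)) S ≡ + (2 ℕ.* bit (lookup S i)) * F̂ g S
    eigen i = begin
      F̂ (λ x → g x - g (flipAt i x)) S   ≡⟨ Σ-cong (allCube n) (λ x → distrib (g x) (g (flipAt i x)) (χ S x)) ⟩
      Σ (allCube n) (λ x → g x * χ S x - g (flipAt i x) * χ S x)
                                          ≡⟨ Σ-- (allCube n) _ _ ⟩
      F̂ g S - F̂ (λ x → g (flipAt i x)) S ≡⟨ cong (λ t → F̂ g S - t) (F̂-flipAt g i S) ⟩
      F̂ g S - sgn (lookup S i) * F̂ g S   ≡⟨ one-minus-sgn (lookup S i) (F̂ g S) ⟩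
      + (2 ℕ.* bit (lookup S i)) * F̂ g S ∎

  -- For a ±1 function, (L f)(x) = 2 f(x) s_f(x): each sensitive direction
  -- contributes f x − (−f x) = 2 f x, every other direction 0.
  laplacian-sign : ∀ {n} (f : Cube n → ℤ) → IsPM1 f → ∀ x →
                   laplacian f x ≡ (+ 2 * f x) * + sensAt f x
  laplacian-sign {n} f pm x = count (allFin n)
    where
    count : ∀ L → Σ L (λ i → f x - f (flipAt i x))
                  ≡ (+ 2 * f x) * + length (filter (λ i → ¬? (f (flipAt i x) ℤP.≟ f x)) L)
    count [] = sym (ℤP.*-zeroʳ (+ 2 * f x))
    count (i ∷ L) with f (flipAt i x) ℤP.≟ f x
    ... | yes same = begin
      (f x - f (flipAt i x)) + Σ L _ ≡⟨ cong (λ t → (f x - t) + Σ L (λ j → f x - f (flipAt j x))) same ⟩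
      (f x - f x) + Σ L _            ≡⟨ cong (_+ Σ L (λ j → f x - f (flipAt j x))) (ℤP.+-inverseʳ (f x)) ⟩
      + 0 + Σ L _                    ≡⟨ ℤP.+-identityˡ _ ⟩
      Σ L _                          ≡⟨ count L ⟩
      _                              ∎
      where open ≡-Reasoning
    ... | no differs = trans (cong₂ _+_ (sign-difference (pm x) (pm (flipAt i x)) differs) (count L))
                             (one-more (+ 2 * f x) _)
      where
      one-more : ∀ a m → a + a * m ≡ a * (+ 1 + m)
      one-more = solve-∀

  -- Spectral identity behind the theorem (Parseval applied to L f):
  -- Σ_S (|S| |F̂ f S|)² = 2^n Σ_x s_f(x)².
  spectral-identity : ∀ {n} (f : Cube n → ℤ) → IsPM1 f →
    ℕΣ.Σ (allCube n) (λ S → (weight S ℕ.* ∣ F̂ f S ∣) ²)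
      ≡ 2 ℕ.^ n ℕ.* ℕΣ.Σ (allCube n) (λ x → sensAt f x ²)
  spectral-identity {n} f pm = ℕP.*-cancelˡ-≡ _ _ 4 (ℤP.+-injective (begin
    + (4 ℕ.* ℕΣ.Σ (allCube n) (λ S → u S ²))
      ≡⟨ cong +_ (sym (ℕΣ.Σ-*ˡ (allCube n) 4 _)) ⟩
    + ℕΣ.Σ (allCube n) (λ S → 4 ℕ.* u S ²)
      ≡⟨ trans (+-Σ (allCube n) _) (sym (Σ-cong (allCube n) spectrum-squared)) ⟩
    Σ (allCube n) (λ S → F̂ Lf S * F̂ Lf S)
      ≡⟨ parseval n Lf ⟩
    + (2 ℕ.^ n) * Σ (allCube n) (λ x → Lf x * Lf x)
      ≡⟨ cong (+ (2 ℕ.^ n) *_) (trans (Σ-cong (allCube n) values-squared) (sym (+-Σ (allCube n) _))) ⟩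
    + (2 ℕ.^ n) * + ℕΣ.Σ (allCube n) (λ x → 4 ℕ.* sensAt f x ²)
      ≡⟨ cong (λ t → + (2 ℕ.^ n) * + t) (ℕΣ.Σ-*ˡ (allCube n) 4 _) ⟩
    + (2 ℕ.^ n) * + (4 ℕ.* ℕΣ.Σ (allCube n) (λ x → sensAt f x ²))
      ≡⟨ sym (ℤP.pos-* (2 ℕ.^ n) _) ⟩
    + (2 ℕ.^ n ℕ.* (4 ℕ.* ℕΣ.Σ (allCube n) (λ x → sensAt f x ²)))
      ≡⟨ cong +_ (swap (2 ℕ.^ n) 4 _) ⟩
    + (4 ℕ.* (2 ℕ.^ n ℕ.* ℕΣ.Σ (allCube n) (λ x → sensAt f x ²)))
      ∎))
    where
    open ≡-Reasoning
    Lf = laplacian f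
    swap : ∀ a b c → a ℕ.* (b ℕ.* c) ≡ b ℕ.* (a ℕ.* c)
    swap = ℕSolver.solve-∀
    u : Cube n → ℕ
    u S = weight S ℕ.* ∣ F̂ f S ∣
    double-square : ∀ m → (2 ℕ.* m) ℕ.* (2 ℕ.* m) ≡ 4 ℕ.* (m ℕ.* m)
    double-square = ℕSolver.solve-∀
    square-of-double : ∀ a m → ∣ a ∣ ≡ 2 ℕ.* m → a * a ≡ + (4 ℕ.* m ²)
    square-of-double a m ∣a∣≡2m = trans (square-∣∣ a) (cong +_ (begin
      ∣ a ∣ ²        ≡⟨ cong _² ∣a∣≡2m ⟩
      (2 ℕ.* m) ²    ≡⟨ double-square m ⟩
      4 ℕ.* m ²      ∎))
    spectrum-squared : ∀ S → F̂ Lf S * F̂ Lf S ≡ + (4 ℕ.* u S ²)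
    spectrum-squared S = square-of-double (F̂ Lf S) (u S) (begin
      ∣ F̂ Lf S ∣                          ≡⟨ cong ∣_∣ (F̂-laplacian f S) ⟩
      ∣ + (2 ℕ.* weight S) * F̂ f S ∣      ≡⟨ ℤP.abs-* (+ (2 ℕ.* weight S)) (F̂ f S) ⟩
      2 ℕ.* weight S ℕ.* ∣ F̂ f S ∣        ≡⟨ ℕP.*-assoc 2 (weight S) _ ⟩
      2 ℕ.* u S                           ∎)
    values-squared : ∀ x → Lf x * Lf x ≡ + (4 ℕ.* sensAt f x ²)
    values-squared x = square-of-double (Lf x) (sensAt f x) (begin
      ∣ Lf x ∣                            ≡⟨ cong ∣_∣ (laplacian-sign f pm x) ⟩
      ∣ (+ 2 * f x) * + sensAt f x ∣      ≡⟨ ℤP.abs-* (+ 2 * f x) _ ⟩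
      ∣ + 2 * f x ∣ ℕ.* sensAt f x        ≡⟨ cong (ℕ._* sensAt f x) (ℤP.abs-* (+ 2) (f x)) ⟩
      2 ℕ.* ∣ f x ∣ ℕ.* sensAt f x        ≡⟨ cong (λ m → 2 ℕ.* m ℕ.* sensAt f x) (∣sign∣ (pm x)) ⟩
      2 ℕ.* 1 ℕ.* sensAt f x              ≡⟨ cong (ℕ._* sensAt f x) (ℕP.*-identityʳ 2) ⟩
      2 ℕ.* sensAt f x                    ∎)

open import Data.Nat using (ℕ; _*_; _≤_)
open import Data.Integer using (ℤ)
open import Data.Integer as ℤ using (∣_∣)
open import Data.Vec using (lookup)
open import Data.Nat using (_+_; _^_; _⊔_; >-nonZero)
open import Data.Nat.Properties
import Data.Nat.Tactic.RingSolver as ℕSolver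
import Data.Integer.Properties as ℤP
open import Data.List.Properties using (length-++; length-map; length-tabulate)
open import Data.List.Membership.Propositional using (_∈_)
open import Data.List.Membership.Propositional.Properties using (∈-++⁺ˡ; ∈-++⁺ʳ; ∈-map⁺)
open import Data.List.Relation.Unary.Any using (here; there)
open import Data.Product using (_,_)
open import Data.Sum using (inj₁; inj₂)
open import Relation.Binary.PropositionalEquality
open import Relation.Nullary using (¬_; yes; no)
open import Relation.Nullary.Decidable using (¬?; decidable-stable)
open import Relation.Unary using (Pred; Decidable)
open import Level using (Level)
open Sums +-*-commutativeSemiring
open Fourier using (F̂; bit; weight; influence-bound; spectral-identity)

Σ-mono : {A : Set} (L : List A) {φ ψ : A → ℕ} → (∀ x → φ x ≤ ψ x) → Σ L φ ≤ Σ L ψ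
Σ-mono []      φ≤ψ = ≤-refl
Σ-mono (x ∷ L) φ≤ψ = +-mono-≤ (φ≤ψ x) (Σ-mono L φ≤ψ)

Σ-const : {A : Set} (L : List A) (c : ℕ) → Σ L (λ _ → c) ≡ length L * c
Σ-const []      c = refl
Σ-const (x ∷ L) c = cong (c +_) (Σ-const L c)

Σ-filter : {A : Set} {p : Level} {P : Pred A p} (P? : Decidable P) (L : List A) (φ : A → ℕ) →
           (∀ x → ¬ P x → φ x ≡ 0) → Σ (filter P? L) φ ≡ Σ L φ
Σ-filter P? []      φ vanish = refl
Σ-filter P? (x ∷ L) φ vanish with P? x
... | yes _  = cong (φ x +_) (Σ-filter P? L φ vanish)
... | no ¬Px = trans (Σ-filter P? L φ vanish) (cong (_+ Σ L φ) (sym (vanish x ¬Px)))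

length-allCube : ∀ n → length (allCube n) ≡ 2 ^ n
length-allCube zero    = refl
length-allCube (suc n) = begin
  length (map (false ∷_) (allCube n) ++ map (true ∷_) (allCube n))
    ≡⟨ length-++ (map (false ∷_) (allCube n)) ⟩
  length (map (false ∷_) (allCube n)) + length (map (true ∷_) (allCube n))
    ≡⟨ cong₂ _+_ (length-map _ (allCube n)) (length-map _ (allCube n)) ⟩
  length (allCube n) + length (allCube n)
    ≡⟨ cong (λ m → m + m) (length-allCube n) ⟩
  2 ^ n + 2 ^ n
    ≡⟨ cong (2 ^ n +_) (sym (+-identityʳ (2 ^ n))) ⟩
  2 ^ suc n ∎
  where open ≡-Reasoning

allCube-complete : ∀ {n} (x : Cube n) → x ∈ allCube n
allCube-complete []                = here refl
allCube-complete {suc n} (false ∷ x) = ∈-++⁺ˡ (∈-map⁺ (false ∷_) (allCube-complete x))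
allCube-complete {suc n} (true ∷ x)  = ∈-++⁺ʳ (map (false ∷_) (allCube n)) (∈-map⁺ (true ∷_) (allCube-complete x))

foldr-⊔-upper : {A : Set} (g : A → ℕ) (L : List A) {x : A} → x ∈ L →
                g x ≤ foldr (λ y m → g y ⊔ m) 0 L
foldr-⊔-upper g (y ∷ L) (here refl) = m≤m⊔n (g y) _
foldr-⊔-upper g (y ∷ L) (there x∈L) = ≤-trans (foldr-⊔-upper g L x∈L) (m≤n⊔m (g y) _)

sensAt≤sensitivity : ∀ {n} (f : Cube n → ℤ) (x : Cube n) → sensAt f x ≤ sensitivity f
sensAt≤sensitivity {n} f x = foldr-⊔-upper (sensAt f) (allCube n) (allCube-complete x)

Σ-sensAt²-bound : ∀ {n} (f : Cube n → ℤ) → Σ (allCube n) (λ x → sensAt f x ²) ≤ 2 ^ n * sensitivity f ²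
Σ-sensAt²-bound {n} f = begin
  Σ (allCube n) (λ x → sensAt f x ²)     ≤⟨ Σ-mono (allCube n) (λ x → *-mono-≤ (bound x) (bound x)) ⟩
  Σ (allCube n) (λ _ → sensitivity f ²)  ≡⟨ Σ-const (allCube n) _ ⟩
  length (allCube n) * sensitivity f ²   ≡⟨ cong (_* sensitivity f ²) (length-allCube n) ⟩
  2 ^ n * sensitivity f ²                ∎
  where
  open ≤-Reasoning
  bound = sensAt≤sensitivity f

total-influence-bound : ∀ {n} (f : Cube n → ℤ) → IsPM1 f → DependsOnAll f →
                        n * 2 ^ n ≤ Σ (allCube n) (λ S → weight S * ∣ F̂ f S ∣)
total-influence-bound {n} f pm dep = begin
  n * 2 ^ n                               ≡⟨ cong (_* 2 ^ n) (sym (length-tabulate {n = n} (λ i → i))) ⟩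
  length (allFin n) * 2 ^ n               ≡⟨ sym (Σ-const (allFin n) (2 ^ n)) ⟩
  Σ (allFin n) (λ _ → 2 ^ n)              ≤⟨ Σ-mono (allFin n) (λ i → influence-bound f pm i (dep i)) ⟩
  Σ (allFin n) (λ i → Σ (allCube n) (λ S → bit (lookup S i) * ∣ F̂ f S ∣))
                                          ≡⟨ Σ-swap (allFin n) (allCube n) _ ⟩
  Σ (allCube n) (λ S → Σ (allFin n) (λ i → bit (lookup S i) * ∣ F̂ f S ∣))
                                          ≡⟨ Σ-cong (allCube n) (λ S → Σ-*ʳ (allFin n) ∣ F̂ f S ∣ _) ⟩
  Σ (allCube n) (λ S → weight S * ∣ F̂ f S ∣) ∎
  where open ≤-Reasoning

-- 2ab ≤ a² + b² over ℕ, first for a ≤ b: with b = a + d the gap is exactly d².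
2ab≤a²+b²-ordered : ∀ {a b} → a ≤ b → 2 * (a * b) ≤ a ² + b ²
2ab≤a²+b²-ordered {a} a≤b with m≤n⇒∃[o]m+o≡n a≤b
... | d , refl = ≤-trans (m≤m+n _ (d * d)) (≤-reflexive (expand a d))
  where
  expand : ∀ a d → 2 * (a * (a + d)) + d * d ≡ a * a + (a + d) * (a + d)
  expand = ℕSolver.solve-∀

2ab≤a²+b² : ∀ a b → 2 * (a * b) ≤ a ² + b ²
2ab≤a²+b² a b with ≤-total a b
... | inj₁ a≤b = 2ab≤a²+b²-ordered a≤b
... | inj₂ b≤a = subst₂ _≤_ (cong (2 *_) (*-comm b a)) (+-comm (b ²) (a ²)) (2ab≤a²+b²-ordered b≤a)

-- Cauchy–Schwarz: (Σ φ)² ≤ |L| Σ φ², from 2 φx φy ≤ φx² + φy² summed over all pairs.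
cauchy-schwarz : {A : Set} (L : List A) (φ : A → ℕ) → Σ L φ ² ≤ length L * Σ L (λ x → φ x ²)
cauchy-schwarz L φ = *-cancelˡ-≤ 2 (begin
  2 * (Σ L φ * Σ L φ)                          ≡⟨ cong (2 *_) (sym (Σ-product L φ φ)) ⟩
  2 * Σ L (λ x → Σ L (λ y → φ x * φ y))        ≡⟨ sym (trans (Σ-cong L (λ x → Σ-*ˡ L 2 _)) (Σ-*ˡ L 2 _)) ⟩
  Σ L (λ x → Σ L (λ y → 2 * (φ x * φ y)))      ≤⟨ Σ-mono L (λ x → Σ-mono L (λ y → 2ab≤a²+b² (φ x) (φ y))) ⟩
  Σ L (λ x → Σ L (λ y → φ x ² + φ y ²))        ≡⟨ Σ-cong L (λ x → trans (Σ-+ L _ _) (cong (_+ Q) (Σ-const L (φ x ²)))) ⟩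
  Σ L (λ x → m * φ x ² + Q)                    ≡⟨ Σ-+ L _ _ ⟩
  Σ L (λ x → m * φ x ²) + Σ L (λ _ → Q)        ≡⟨ cong₂ _+_ (Σ-*ˡ L m _) (Σ-const L Q) ⟩
  m * Q + m * Q                                ≡⟨ cong (m * Q +_) (sym (+-identityʳ (m * Q))) ⟩
  2 * (m * Q)                                  ∎)
  where
  open ≤-Reasoning
  m = length L
  Q = Σ L (λ x → φ x ²)

corollary15 : (n : ℕ) (f : Cube n → ℤ) → IsPM1 f → DependsOnAll f →
    n * n ≤ (sensitivity f * sensitivity f) * sparsity f
corollary15 n f pm dep = *-cancelʳ-≤ (n * n) _ (N * N) {{>-nonZero (*-mono-< (m^n>0 2 n) (m^n>0 2 n))}} (begin
  n * n * (N * N)                        ≡⟨ rearrange n N ⟩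
  (n * N) ²                              ≤⟨ *-mono-≤ influence influence ⟩
  Σ (allCube n) u ²                      ≡⟨ cong _² (sym (Σ-filter nonzero? (allCube n) u vanish)) ⟩
  Σ support u ²                          ≤⟨ cauchy-schwarz support u ⟩
  k * Σ support (λ S → u S ²)            ≡⟨ cong (k *_) (Σ-filter nonzero? (allCube n) (λ S → u S ²) (λ S z → cong _² (vanish S z))) ⟩
  k * Σ (allCube n) (λ S → u S ²)        ≡⟨ cong (k *_) (spectral-identity f pm) ⟩
  k * (N * Σ (allCube n) (λ x → sensAt f x ²)) ≤⟨ *-monoʳ-≤ k (*-monoʳ-≤ N (Σ-sensAt²-bound f)) ⟩
  k * (N * (N * s ²))                    ≡⟨ regroup k N s ⟩
  s * s * k * (N * N)                    ∎)
  where
  open ≤-Reasoning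
  N = 2 ^ n
  s = sensitivity f
  k = sparsity f
  u : Cube n → ℕ
  u S = weight S * ∣ F̂ f S ∣
  nonzero? = λ S → ¬? (F̂ f S ℤP.≟ ℤ.+ 0)
  support = filter nonzero? (allCube n)
  influence = total-influence-bound f pm dep
  vanish : ∀ S → ¬ ¬ F̂ f S ≡ ℤ.+ 0 → u S ≡ 0
  vanish S ¬¬zero = trans (cong (λ t → weight S * ∣ t ∣) (decidable-stable (F̂ f S ℤP.≟ ℤ.+ 0) ¬¬zero))
                          (*-zeroʳ (weight S))
  rearrange : ∀ n N → n * n * (N * N) ≡ (n * N) * (n * N)
  rearrange = ℕSolver.solve-∀
  regroup : ∀ k N s → k * (N * (N * (s * s))) ≡ s * s * k * (N * N)
  regroup = ℕSolver.solve-∀
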